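{- Let $N$ be a homogeneous network with asymmetric inputs with set of cells $C$, and let $\tilde{N}$ be its fundamental network with set of cells $\tilde{C}$. Suppose $N$ is backward connected for $c\in C$. (i) If $\varphi:N\to\tilde{N}$ is a network fibration, then $\sigma'\circ\varphi(c)=\sigma''\circ\varphi(c)$ for all $\sigma',\sigma''\in\tilde{C}$ with $\sigma'(c)=\sigma''(c)$. (ii) If there is $\sigma\in\tilde{C}$ such that $\sigma'\circ\sigma=\sigma''\circ\sigma$ for all $\sigma',\sigma''\in\tilde{C}$ with $\sigma'(c)=\sigma''(c)$, then there is a network fibration $\varphi:N\to\tilde{N}$ with $\varphi(c)=\sigma$.
   Context: A homogeneous network with asymmetric inputs has a finite cell set $C$, one cell type, $k$ edge types, each cell receiving exactly one edge of each type; it is represented by $\sigma_1,\dots,\sigma_k:C\to C$ (type-$i$ edge into $c$ comes from $\sigma_i(c)$). A network fibration between two such networks (same edge types) represented by $(\sigma_i)$, $(\sigma'_i)$ is (determined by) a cell map $\varphi$ with $\varphi\circ\sigma_i=\sigma'_i\circ\varphi$ for all $i$. $N$ is backward connected for $c$ if every cell $c'\neq c$ has a directed path to $c$, i.e. $c'=\sigma_{j_m}\circ\dots\circ\sigma_{j_1}(c)$ for some indices. The fundamental network $\tilde{N}$ has as cells the semigroup $\tilde{C}$ of maps $C\to C$ generated under composition by $Id_C,\sigma_1,\dots,\sigma_k$, represented by $\tilde{\sigma}_i(\gamma)=\sigma_i\circ\gamma$. -}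

module Defs where

open import Data.Nat using (ℕ)
open import Data.Fin using (Fin)
open import Data.Product using (Σ; ∃; _×_; _,_; proj₁)
open import Relation.Binary.PropositionalEquality using (_≡_)
open import Relation.Nullary using (¬_)
open import Function using (_∘_; id)

-- A homogeneous network with asymmetric inputs: cells Fin n, k edge types,
-- σ i c = source of the type-i edge into c.
Network : ℕ → ℕ → Set
Network n k = Fin k → Fin n → Fin n

Map : ℕ → Set
Map n = Fin n → Fin n

_≗ₘ_ : ∀ {n} → Map n → Map n → Set
f ≗ₘ g = ∀ x → f x ≡ g x

-- Membership in the semigroup generated by Id, σ_1,…,σ_k under composition
-- (every element is a word σ_{j_m} ∘ … ∘ σ_{j_1}, possibly empty = Id).
data Generated {n k : ℕ} (σ : Network n k) : Map n → Set where
  gen-id   : Generated σ id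
  gen-step : ∀ (i : Fin k) {γ : Map n} → Generated σ γ → Generated σ (σ i ∘ γ)

FCell : ∀ {n k} → Network n k → Set
FCell σ = Σ (Map _) (Generated σ)

_≈C_ : ∀ {n k} {σ : Network n k} → FCell σ → FCell σ → Set
a ≈C b = proj₁ a ≗ₘ proj₁ b

σ̃ : ∀ {n k} (σ : Network n k) → Fin k → FCell σ → FCell σ
σ̃ σ i (γ , g) = (σ i ∘ γ , gen-step i g)

IsFibrationToFund : ∀ {n k} (σ : Network n k) → (Fin n → FCell σ) → Set
IsFibrationToFund {k = k} σ φ = ∀ (i : Fin k) c → φ (σ i c) ≈C σ̃ σ i (φ c)

BackwardConnected : ∀ {n k} → Network n k → Fin n → Set
BackwardConnected {n} σ c =
  ∀ (c' : Fin n) → ¬ (c' ≡ c) → ∃ λ (γ : Map n) → Generated σ γ × (c' ≡ γ c)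

-- A fibration φ : N → Ñ satisfies φ(γ c) = γ ∘ φ(c) for every word γ, and by
-- backward connectivity every cell has the form γ c. Hence (i): if σ' c = σ'' c
-- then σ' ∘ φ(c) = φ(σ' c) = φ(σ'' c) = σ'' ∘ φ(c). Conversely, (ii) defines
-- φ(γ c) := γ ∘ σ; the hypothesis on σ is exactly what makes this independent
-- of the chosen word γ, and the fibration equations are then instances of it.
module Submission where

open import Defs
open import Data.Nat using (ℕ)
open import Data.Fin using (Fin; _≟_)
open import Data.Product using (Σ; ∃; _×_; _,_; proj₁; proj₂)
open import Relation.Binary.PropositionalEquality using (_≡_; refl; sym; trans; cong)
open import Relation.Nullary using (yes; no)
open import Function using (_∘_; id)

Generated-∘ : ∀ {n k} {σ : Network n k} {γ δ : Map n} →
              Generated σ γ → Generated σ δ → Generated σ (γ ∘ δ)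
Generated-∘ gen-id           gδ = gδ
Generated-∘ (gen-step i gγ) gδ = gen-step i (Generated-∘ gγ gδ)

module _ {n k : ℕ} (σ : Network n k) where

  AgreesAfter : Fin n → FCell σ → Set
  AgreesAfter c (s , _) =
    ∀ (s' s'' : FCell σ) → proj₁ s' c ≡ proj₁ s'' c → (proj₁ s' ∘ s) ≗ₘ (proj₁ s'' ∘ s)

  fibration-word : (φ : Fin n → FCell σ) → IsFibrationToFund σ φ →
                   ∀ c {γ} → Generated σ γ → proj₁ (φ (γ c)) ≗ₘ (γ ∘ proj₁ (φ c))
  fibration-word φ isFib c gen-id              x = refl
  fibration-word φ isFib c (gen-step i {γ} gγ) x =
    trans (isFib i (γ c) x) (cong (σ i) (fibration-word φ isFib c gγ x))

  fibration-agreesAfter : (φ : Fin n → FCell σ) → IsFibrationToFund σ φ →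
                          ∀ c → AgreesAfter c (φ c)
  fibration-agreesAfter φ isFib c (s' , gs') (s'' , gs'') s'c≡s''c x =
    trans (sym (fibration-word φ isFib c gs' x))
          (trans (cong (λ d → proj₁ (φ d) x) s'c≡s''c) (fibration-word φ isFib c gs'' x))

  reachable : ∀ c → BackwardConnected σ c →
              ∀ c' → ∃ λ (γ : Map n) → Generated σ γ × (c' ≡ γ c)
  reachable c connected c' with c' ≟ c
  ... | yes c'≡c = id , gen-id , c'≡c
  ... | no  c'≢c = connected c' c'≢c

  module _ (c : Fin n) (connected : BackwardConnected σ c) where

    private
      word : Fin n → FCell σ
      word c' = proj₁ (reachable c connected c') , proj₁ (proj₂ (reachable c connected c'))

      word-reaches : ∀ c' → c' ≡ proj₁ (word c') c
      word-reaches c' = proj₂ (proj₂ (reachable c connected c'))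

    fibrationThrough : FCell σ → Fin n → FCell σ
    fibrationThrough (s , gs) c' = proj₁ (word c') ∘ s , Generated-∘ (proj₂ (word c')) gs

    fibrationThrough-isFibration : ∀ s → AgreesAfter c s →
                                   IsFibrationToFund σ (fibrationThrough s)
    fibrationThrough-isFibration s agrees i c' =
      agrees (word (σ i c')) (σ̃ σ i (word c'))
             (trans (sym (word-reaches (σ i c'))) (cong (σ i) (word-reaches c')))

    fibrationThrough-base : ∀ s → AgreesAfter c s → fibrationThrough s c ≈C s
    fibrationThrough-base s agrees = agrees (word c) (id , gen-id) (sym (word-reaches c))

mainTheorem9 : ∀ {n k : ℕ} (σ : Network n k) (c : Fin n) → BackwardConnected σ c →
    ((φ : Fin n → FCell σ) → IsFibrationToFund σ φ →
      ∀ (s' s'' : FCell σ) → proj₁ s' c ≡ proj₁ s'' c →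
        (proj₁ s' ∘ proj₁ (φ c)) ≗ₘ (proj₁ s'' ∘ proj₁ (φ c)))
  × (∀ (s : FCell σ) →
      (∀ (s' s'' : FCell σ) → proj₁ s' c ≡ proj₁ s'' c →
        (proj₁ s' ∘ proj₁ s) ≗ₘ (proj₁ s'' ∘ proj₁ s)) →
      Σ (Fin n → FCell σ) λ φ → IsFibrationToFund σ φ × (φ c ≈C s))
mainTheorem9 σ c connected =
    (λ φ isFib → fibration-agreesAfter σ φ isFib c)
  , (λ s agrees → fibrationThrough σ c connected s
                , fibrationThrough-isFibration σ c connected s agrees
                , fibrationThrough-base σ c connected s agrees)
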